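{- Over $\mathsf{CK}$, the axiom $I_{\Diamond\Box}$ implies the axiom $\mathsf{wCD}$; that is, $\Box(p\vee q)\to((\Diamond p\to\Box q)\to\Box q)$ is derivable in $\mathsf{CK}\oplus I_{\Diamond\Box}$.
   Context: Formulas are built from a countably infinite set of propositional variables by $\varphi ::= p \mid \bot \mid \varphi\wedge\varphi \mid \varphi\vee\varphi \mid \varphi\to\varphi \mid \Box\varphi \mid \Diamond\varphi$. For a set $\mathsf{Ax}$ of formulas, $\mathsf{CK}\oplus\mathsf{Ax}$ is the logic whose derivable formulas are generated by: substitution instances of axioms of a standard Hilbert axiomatisation of intuitionistic propositional logic, of $\Box(p\to q)\to(\Box p\to\Box q)$, of $\Box(p\to q)\to(\Diamond p\to\Diamond q)$, and of formulas in $\mathsf{Ax}$; modus ponens; necessitation (from $\varphi$ infer $\Box\varphi$). $I_{\Diamond\Box}$: $(\Diamond p\to\Box q)\to\Box(p\to q)$. -}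

module Defs where

open import Data.Nat using (ℕ; zero; suc)
open import Level using (Level; suc; _⊔_)

infixr 5 _⇒_
infixr 6 _∨′_
infixr 7 _∧′_
data Fm : Set where
  var  : ℕ → Fm
  ⊥′   : Fm
  _∧′_ : Fm → Fm → Fm
  _∨′_ : Fm → Fm → Fm
  _⇒_  : Fm → Fm → Fm
  □    : Fm → Fm
  ◇    : Fm → Fm

Subst : Set
Subst = ℕ → Fm

_[_] : Fm → Subst → Fm
var n    [ σ ] = σ n
⊥′       [ σ ] = ⊥′
(a ∧′ b) [ σ ] = (a [ σ ]) ∧′ (b [ σ ])
(a ∨′ b) [ σ ] = (a [ σ ]) ∨′ (b [ σ ])
(a ⇒ b)  [ σ ] = (a [ σ ]) ⇒ (b [ σ ])
□ a      [ σ ] = □ (a [ σ ])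
◇ a      [ σ ] = ◇ (a [ σ ])

p q r : Fm
p = var 0
q = var 1
r = var 2

-- Standard Hilbert axioms of intuitionistic propositional logic (as formulas
-- in the variables p, q, r; their substitution instances are the axioms).
data IPCAx : Fm → Set where
  ax-K    : IPCAx (p ⇒ (q ⇒ p))
  ax-S    : IPCAx ((p ⇒ (q ⇒ r)) ⇒ ((p ⇒ q) ⇒ (p ⇒ r)))
  ax-∧I   : IPCAx (p ⇒ (q ⇒ (p ∧′ q)))
  ax-∧E₁  : IPCAx ((p ∧′ q) ⇒ p)
  ax-∧E₂  : IPCAx ((p ∧′ q) ⇒ q)
  ax-∨I₁  : IPCAx (p ⇒ (p ∨′ q))
  ax-∨I₂  : IPCAx (q ⇒ (p ∨′ q))
  ax-∨E   : IPCAx ((p ⇒ r) ⇒ ((q ⇒ r) ⇒ ((p ∨′ q) ⇒ r)))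
  ax-⊥E   : IPCAx (⊥′ ⇒ p)

data CKAx : Fm → Set where
  ax-K□ : CKAx (□ (p ⇒ q) ⇒ (□ p ⇒ □ q))
  ax-K◇ : CKAx (□ (p ⇒ q) ⇒ (◇ p ⇒ ◇ q))

data _⊢_ {ℓ : Level} (Ax : Fm → Set ℓ) : Fm → Set ℓ where
  ipc  : ∀ {φ} → IPCAx φ → (σ : Subst) → Ax ⊢ (φ [ σ ])
  ck   : ∀ {φ} → CKAx φ → (σ : Subst) → Ax ⊢ (φ [ σ ])
  extra : ∀ {φ} → Ax φ → (σ : Subst) → Ax ⊢ (φ [ σ ])
  mp   : ∀ {φ ψ} → Ax ⊢ (φ ⇒ ψ) → Ax ⊢ φ → Ax ⊢ ψ
  nec  : ∀ {φ} → Ax ⊢ φ → Ax ⊢ □ φ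

I◇□ : Fm
I◇□ = (◇ p ⇒ □ q) ⇒ □ (p ⇒ q)

data I◇□Ax : Fm → Set where
  is-I◇□ : I◇□Ax I◇□

wCD : Fm
wCD = □ (p ∨′ q) ⇒ ((◇ p ⇒ □ q) ⇒ □ q)

{-# OPTIONS --safe #-}
module Submission where

open import Data.Nat using (zero; suc)
open import Level using (Level)
open import Defs

-- I◇□ turns the hypothesis ◇p → □q into □(p → q). Necessitating the
-- intuitionistic tautology (p → q) → (p ∨ q → q) and distributing □ over it
-- then turns □(p → q) into □(p ∨ q) → □q.

subst₃ : Fm → Fm → Fm → Subst
subst₃ a b c zero          = a
subst₃ a b c (suc zero)    = b
subst₃ a b c (suc (suc _)) = c

module _ {ℓ : Level} {Ax : Fm → Set ℓ} where

  ⇒-weaken : ∀ a b → Ax ⊢ (a ⇒ (b ⇒ a))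
  ⇒-weaken a b = ipc ax-K (subst₃ a b ⊥′)

  ⇒-distrib : ∀ a b c → Ax ⊢ ((a ⇒ (b ⇒ c)) ⇒ ((a ⇒ b) ⇒ (a ⇒ c)))
  ⇒-distrib a b c = ipc ax-S (subst₃ a b c)

  □-distrib : ∀ a b → Ax ⊢ (□ (a ⇒ b) ⇒ (□ a ⇒ □ b))
  □-distrib a b = ck ax-K□ (subst₃ a b ⊥′)

  ⇒-refl : ∀ a → Ax ⊢ (a ⇒ a)
  ⇒-refl a = mp (mp (⇒-distrib a (a ⇒ a) a) (⇒-weaken a (a ⇒ a))) (⇒-weaken a a)

  ⇒-trans : ∀ {a b c} → Ax ⊢ (a ⇒ b) → Ax ⊢ (b ⇒ c) → Ax ⊢ (a ⇒ c)
  ⇒-trans {a} {b} {c} f g = mp (mp (⇒-distrib a b c) (mp (⇒-weaken (b ⇒ c) a) g)) f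

  ⇒-flip : ∀ {a b c} → Ax ⊢ (a ⇒ (b ⇒ c)) → Ax ⊢ (b ⇒ (a ⇒ c))
  ⇒-flip {a} {b} {c} h = ⇒-trans (⇒-weaken b a) (mp (⇒-distrib a b c) h)

  mp-under : ∀ {a b c} → Ax ⊢ (a ⇒ (b ⇒ c)) → Ax ⊢ b → Ax ⊢ (a ⇒ c)
  mp-under {a} {b} {c} h x = mp (mp (⇒-distrib a b c) h) (mp (⇒-weaken b a) x)

  □-mono : ∀ {a b} → Ax ⊢ (a ⇒ b) → Ax ⊢ (□ a ⇒ □ b)
  □-mono {a} {b} h = mp (□-distrib a b) (nec h)

  ∨-absorb : ∀ a b → Ax ⊢ ((a ⇒ b) ⇒ ((a ∨′ b) ⇒ b))
  ∨-absorb a b = mp-under (ipc ax-∨E (subst₃ a b b)) (⇒-refl b)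

I◇□-axiom : I◇□Ax ⊢ I◇□
I◇□-axiom = extra is-I◇□ (subst₃ p q ⊥′)

mainTheorem18 : I◇□Ax ⊢ wCD
mainTheorem18 = ⇒-flip (⇒-trans I◇□-axiom (⇒-trans □[p⇒q]⇒□[p∨q⇒q] (□-distrib (p ∨′ q) q)))
  where
  □[p⇒q]⇒□[p∨q⇒q] : I◇□Ax ⊢ (□ (p ⇒ q) ⇒ □ ((p ∨′ q) ⇒ q))
  □[p⇒q]⇒□[p∨q⇒q] = □-mono (∨-absorb p q)
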